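{- Let $G$ be a graph and let $\mathcal{O}$ be a perfect odd cover of $G$. Then the even cores of $G$ are precisely the nonempty subsets $W\subseteq V(G)$ such that $|W\cap X|$ and $|W\cap Y|$ are even for every biclique $(X,Y)\in\mathcal{O}$. Consequently, if $G$ has an even core $W$ such that the induced subgraph $G[W]$ has an odd number of edges, then $b_2(G) > r_2(G)/2$.
   Context: Graphs are finite and simple; $r_2(G)$ is the rank over $\mathbb{F}_2$ of the adjacency matrix of $G$. A biclique on a subset of $V(G)$ is a complete bipartite graph given by disjoint parts $(X,Y)$ with $X,Y\subseteq V(G)$. An odd cover of $G$ is a collection of bicliques on subsets of $V(G)$ such that each edge of $G$ is covered (i.e. has one endpoint in $X$ and the other in $Y$) by an odd number of them and each nonedge of $G$ by an even number of them. $b_2(G)$ is the minimum cardinality of an odd cover of $G$; always $b_2(G)\ge r_2(G)/2$, and an odd cover of cardinality $r_2(G)/2$ is a perfect odd cover. An even core of $G$ is a nonempty set $W\subseteq V(G)$ such that every vertex of $G$ has an even number of neighbors in $W$. -}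

module Defs where

open import Data.Nat using (ℕ; zero; suc; _+_; _*_; _<_; _≤_)
open import Data.Nat.Divisibility using (_∣_)
open import Data.Bool using (Bool; true; false; _∧_; _∨_; _xor_; if_then_else_)
open import Data.Fin as Fin using (Fin; toℕ)
open import Data.List using (List; []; _∷_; length; map)
open import Data.List.Relation.Unary.All using (All)
open import Data.Product using (_×_; Σ; ∃; _,_)
open import Relation.Binary.PropositionalEquality using (_≡_; _≢_)
open import Relation.Nullary using (¬_)
open import Relation.Nullary.Decidable using (⌊_⌋)
open import Data.Nat.Properties using (_<?_)

record Graph (n : ℕ) : Set where
  field
    adj   : Fin n → Fin n → Bool
    sym   : ∀ u v → adj u v ≡ adj v u
    irref : ∀ v → adj v v ≡ false
open Graph public

VSet : ℕ → Set
VSet n = Fin n → Bool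

count : ∀ {n} → (Fin n → Bool) → ℕ
count {zero}  f = 0
count {suc n} f = (if f Fin.zero then 1 else 0) + count (λ i → f (Fin.suc i))

Even : ℕ → Set
Even m = 2 ∣ m

Odd : ℕ → Set
Odd m = ¬ Even m

_∩_ : ∀ {n} → VSet n → VSet n → VSet n
(A ∩ B) i = A i ∧ B i

Nonempty : ∀ {n} → VSet n → Set
Nonempty W = ∃ λ i → W i ≡ true

record Biclique (n : ℕ) : Set where
  field
    X : VSet n
    Y : VSet n
    disjoint : ∀ i → X i ∧ Y i ≡ false
    X-nonempty : ∃ λ i → X i ≡ true
    Y-nonempty : ∃ λ i → Y i ≡ true
open Biclique public

covers : ∀ {n} → Biclique n → Fin n → Fin n → Bool
covers B u v = (X B u ∧ Y B v) ∨ (Y B u ∧ X B v)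

coverCount : ∀ {n} → List (Biclique n) → Fin n → Fin n → ℕ
coverCount []       u v = 0
coverCount (B ∷ Bs) u v = (if covers B u v then 1 else 0) + coverCount Bs u v

IsOddCover : ∀ {n} → Graph n → List (Biclique n) → Set
IsOddCover G O = ∀ u v → u ≢ v →
  (adj G u v ≡ true → Odd (coverCount O u v)) ×
  (adj G u v ≡ false → Even (coverCount O u v))

-- Linear algebra over F₂ (Bool with xor as addition, ∧ as multiplication).
Vec₂ : ℕ → Set
Vec₂ n = Fin n → Bool

zeroV : ∀ {n} → Vec₂ n
zeroV _ = false

lincomb : ∀ {n} → List (Bool × Vec₂ n) → Vec₂ n
lincomb []             j = false
lincomb ((c , v) ∷ cs) j = (c ∧ v j) xor lincomb cs j

zipC : ∀ {n} → List Bool → List (Vec₂ n) → List (Bool × Vec₂ n)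
zipC (c ∷ cs) (v ∷ vs) = (c , v) ∷ zipC cs vs
zipC _ _ = []

Independent : ∀ {n} → List (Vec₂ n) → Set
Independent vs = ∀ (cs : List Bool) → length cs ≡ length vs →
  (∀ j → lincomb (zipC cs vs) j ≡ false) → All (_≡ false) cs

IsRank₂ : ∀ {m n} → (Fin m → Vec₂ n) → ℕ → Set
IsRank₂ A r =
  (Σ (List _) λ is → length is ≡ r × Independent (map A is)) ×
  (∀ is → Independent (map A is) → length is ≤ r)

IsR₂ : ∀ {n} → Graph n → ℕ → Set
IsR₂ G r = IsRank₂ (adj G) r

IsEvenCore : ∀ {n} → Graph n → VSet n → Set
IsEvenCore G W = Nonempty W × (∀ v → Even (count (λ w → adj G v w ∧ W w)))

sumFin : ∀ {n} → (Fin n → ℕ) → ℕ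
sumFin {zero}  f = 0
sumFin {suc n} f = f Fin.zero + sumFin (λ i → f (Fin.suc i))

inducedEdges : ∀ {n} → Graph n → VSet n → ℕ
inducedEdges G W = sumFin λ u → count λ v →
  ⌊ toℕ u <? toℕ v ⌋ ∧ adj G u v ∧ W u ∧ W v

{-# OPTIONS --safe #-}
-- Over 𝔽₂ the adjacency matrix of G is the sum of x yᵀ + y xᵀ over the bicliques (X , Y) of an
-- odd cover O, so its rows lie in the span of the 2|O| characteristic vectors of the parts. When
-- 2|O| = r₂(G) an independent set of r₂(G) rows already spans all of them (Steinitz exchange), so
-- W is orthogonal to every row, i.e. is an even core, iff it is orthogonal to every part. For such
-- W the number of edges of G[W] is Σ_{u<v} A u v W u W v ≡ Σ_{(X,Y)} |W ∩ X| |W ∩ Y| ≡ 0 (mod 2),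
-- so an even core inducing an odd number of edges rules out a perfect odd cover.
module Submission where

open import Defs
open import Data.Nat using (ℕ; _*_; _<_)
open import Data.Fin using (Fin)
open import Data.List using (List; length)
open import Data.List.Membership.Propositional using (_∈_)
open import Data.Product using (_×_)
open import Function.Bundles using (_⇔_)
open import Relation.Binary.PropositionalEquality using (_≡_)

open import Algebra.Bundles using (CommutativeRing)
open import Data.Bool as Bool using (Bool; true; false; not; _∧_; _xor_; if_then_else_)
open import Data.Bool.Properties
  using (xor-∧-commutativeRing; ∧-comm; ∧-assoc; ∧-zeroʳ; ∧-identityʳ; ∨-identityʳ;
         xor-identityʳ; xor-same; ∧-distribˡ-xor; ∧-distribʳ-xor; ¬-not)
open import Data.Fin as Fin using (zero; suc; toℕ; punchIn)
open import Data.Fin.Properties using (any?; toℕ-injective)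
open import Data.List using ([]; _∷_; map; lookup; tabulate)
open import Data.List.Properties using (length-tabulate; length-map)
open import Data.List.Relation.Unary.All using (All; []; _∷_)
open import Data.List.Relation.Unary.All.Properties using (tabulate⁻)
open import Data.List.Relation.Unary.Any using (here; there)
open import Data.Maybe using (Maybe; just; nothing)
open import Data.Nat using (zero; suc; _+_; _≤_; z≤n; s≤s)
open import Data.Nat.Divisibility using (divides; _∣0; ∣-refl; ∣m∣n⇒∣m+n)
open import Data.Nat.Properties
  using (*-suc; ≤-reflexive; ≤-trans; m≤n⇒m≤1+n; ≤∧≢⇒<; n≮n; <-asym; ≤∧≮⇒≡; ≮⇒≥;
         _<?_)
open import Data.Product as Product using (∃; _,_; proj₁; proj₂)
open import Data.Vec.Functional as Vector using ()
open import Data.Vec.Functional.Properties using (insertAt-lookup; insertAt-punchIn)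
open import Function using (_∘_)
open import Function.Bundles using (mk⇔)
open import Relation.Binary.PropositionalEquality
  using (_≢_; _≗_; refl; trans; cong; cong₂; subst; module ≡-Reasoning)
import Relation.Binary.PropositionalEquality as ≡
open import Relation.Nullary using (yes; no; contradiction)
open import Relation.Nullary.Decidable using (⌊_⌋)
open import Tactic.RingSolver using (solve-∀)
open import Tactic.RingSolver.Core.AlmostCommutativeRing
  using (AlmostCommutativeRing; fromCommutativeRing)

open import Algebra.Properties.Semiring.Sum (CommutativeRing.semiring xor-∧-commutativeRing)
  using (sum-syntax; sum-cong-≗; sum-replicate-zero; sum-remove; ∑-distrib-+; ∑-comm;
         *-distribˡ-sum; *-distribʳ-sum)

open ≡-Reasoning

private
  variable
    m n : ℕ

-- Coefficients are normalised in Bool itself, so the solver also proves identities that need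
-- x xor x ≡ false.
𝔽₂ : AlmostCommutativeRing _ _
𝔽₂ = fromCommutativeRing xor-∧-commutativeRing isFalse
  where
  isFalse : ∀ x → Maybe (false ≡ x)
  isFalse false = just refl
  isFalse true  = nothing

∑-zero : {f : Fin m → Bool} → (∀ i → f i ≡ false) → ∑[ i < m ] f i ≡ false
∑-zero {m} f≡false = trans (sum-cong-≗ f≡false) (sum-replicate-zero m)

isOdd : ℕ → Bool
isOdd 0             = false
isOdd 1             = true
isOdd (suc (suc n)) = isOdd n

isOdd-suc : ∀ n → isOdd (suc n) ≡ not (isOdd n)
isOdd-suc 0             = refl
isOdd-suc 1             = refl
isOdd-suc (suc (suc n)) = isOdd-suc n

isOdd-+ : ∀ m n → isOdd (m + n) ≡ isOdd m xor isOdd n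
isOdd-+ 0             n = refl
isOdd-+ 1             n = isOdd-suc n
isOdd-+ (suc (suc m)) n = isOdd-+ m n

isOdd-*2 : ∀ q → isOdd (q * 2) ≡ false
isOdd-*2 zero    = refl
isOdd-*2 (suc q) = isOdd-*2 q

even⇒isOdd≡false : ∀ {m} → Even m → isOdd m ≡ false
even⇒isOdd≡false (divides q refl) = isOdd-*2 q

isOdd≡false⇒even : ∀ m → isOdd m ≡ false → Even m
isOdd≡false⇒even 0             _ = 2 ∣0
isOdd≡false⇒even (suc (suc m)) e = ∣m∣n⇒∣m+n ∣-refl (isOdd≡false⇒even m e)

odd⇒isOdd≡true : ∀ m → Odd m → isOdd m ≡ true
odd⇒isOdd≡true m odd with isOdd m in eq
... | true  = refl
... | false = contradiction (isOdd≡false⇒even m eq) odd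

isOdd-indicator : ∀ b → isOdd (if b then 1 else 0) ≡ b
isOdd-indicator true  = refl
isOdd-indicator false = refl

isOdd-count : (f : Fin n → Bool) → isOdd (count f) ≡ ∑[ i < n ] f i
isOdd-count {zero}  f = refl
isOdd-count {suc n} f = trans (isOdd-+ (if f zero then 1 else 0) _)
  (cong₂ _xor_ (isOdd-indicator (f zero)) (isOdd-count (f ∘ suc)))

isOdd-sumFin : (f : Fin n → ℕ) → isOdd (sumFin f) ≡ ∑[ i < n ] isOdd (f i)
isOdd-sumFin {zero}  f = refl
isOdd-sumFin {suc n} f =
  trans (isOdd-+ (f zero) _) (cong (isOdd (f zero) xor_) (isOdd-sumFin (f ∘ suc)))

infixl 8 _⊕_
infixr 9 _·_
infix  7 _∙_
infix  4 _⟂_ _∈Span_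

_⊕_ : Vec₂ n → Vec₂ n → Vec₂ n
(u ⊕ v) j = u j xor v j

_·_ : Bool → Vec₂ n → Vec₂ n
(a · v) j = a ∧ v j

_∙_ : Vec₂ n → Vec₂ n → Bool
_∙_ {n} u v = ∑[ j < n ] (u j ∧ v j)

_⟂_ : Vec₂ n → Vec₂ n → Set
u ⟂ v = u ∙ v ≡ false

⟂-sym : (u v : Vec₂ n) → u ⟂ v → v ⟂ u
⟂-sym u v u⟂v = trans (sum-cong-≗ (λ j → ∧-comm (v j) (u j))) u⟂v

∙-zeroˡ : {u : Vec₂ n} (w : Vec₂ n) → u ≗ zeroV → u ⟂ w
∙-zeroˡ w u≗0 = ∑-zero (λ j → cong (_∧ w j) (u≗0 j))

∙-⊕· : (u s w : Vec₂ n) (a : Bool) → (u ⊕ a · s) ∙ w ≡ (u ∙ w) xor (a ∧ s ∙ w)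
∙-⊕· u s w a = begin
  (u ⊕ a · s) ∙ w
    ≡⟨ sum-cong-≗ (λ j → ∧-distribʳ-xor (w j) (u j) (a ∧ s j)) ⟩
  ∑[ j < _ ] ((u j ∧ w j) xor ((a ∧ s j) ∧ w j))
    ≡⟨ ∑-distrib-+ (λ j → u j ∧ w j) (λ j → (a ∧ s j) ∧ w j) ⟩
  (u ∙ w) xor ∑[ j < _ ] ((a ∧ s j) ∧ w j)
    ≡⟨ cong ((u ∙ w) xor_) (sum-cong-≗ (λ j → ∧-assoc a (s j) (w j))) ⟩
  (u ∙ w) xor ∑[ j < _ ] (a ∧ (s j ∧ w j))
    ≡⟨ cong ((u ∙ w) xor_) (*-distribˡ-sum a (λ j → s j ∧ w j)) ⟨
  (u ∙ w) xor (a ∧ s ∙ w) ∎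

_∈Span_ : Vec₂ n → List (Vec₂ n) → Set
v ∈Span []      = v ≗ zeroV
v ∈Span (s ∷ S) = ∃ λ a → v ⊕ a · s ∈Span S

∈Span-resp-≗ : {u v : Vec₂ n} (S : List (Vec₂ n)) → u ≗ v → u ∈Span S → v ∈Span S
∈Span-resp-≗ []      u≗v u∈S j       = trans (≡.sym (u≗v j)) (u∈S j)
∈Span-resp-≗ (s ∷ S) u≗v (a , u∈S) =
  a , ∈Span-resp-≗ S (λ j → cong (_xor (a ∧ s j)) (u≗v j)) u∈S

zero∈Span : (S : List (Vec₂ n)) → zeroV ∈Span S
zero∈Span []      j = refl
zero∈Span (s ∷ S)   = false , zero∈Span S

∈Span-⊕ : {u v : Vec₂ n} (S : List (Vec₂ n)) → u ∈Span S → v ∈Span S → u ⊕ v ∈Span S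
∈Span-⊕ []      u∈S v∈S j = cong₂ _xor_ (u∈S j) (v∈S j)
∈Span-⊕ {u = u} {v} (s ∷ S) (a , u∈S) (b , v∈S) =
  a xor b , ∈Span-resp-≗ S (λ j → regroup (u j) (v j) a b (s j)) (∈Span-⊕ S u∈S v∈S)
  where
  regroup : ∀ x y a b z → (x xor (a ∧ z)) xor (y xor (b ∧ z)) ≡ (x xor y) xor ((a xor b) ∧ z)
  regroup = solve-∀ 𝔽₂

∈Span-· : {v : Vec₂ n} (S : List (Vec₂ n)) (a : Bool) → v ∈Span S → a · v ∈Span S
∈Span-· S false _   = zero∈Span S
∈Span-· S true  v∈S = v∈S

∈⇒∈Span : {s : Vec₂ n} {S : List (Vec₂ n)} → s ∈ S → s ∈Span S
∈⇒∈Span {s = s} {s ∷ S} (here refl) =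
  true , ∈Span-resp-≗ S (λ j → ≡.sym (xor-same (s j))) (zero∈Span S)
∈⇒∈Span {s = s} {t ∷ S} (there s∈S) =
  false , ∈Span-resp-≗ S (λ j → ≡.sym (xor-identityʳ (s j))) (∈⇒∈Span s∈S)

∈Span-⟂ : {v w : Vec₂ n} {S : List (Vec₂ n)} → All (_⟂ w) S → v ∈Span S → v ⟂ w
∈Span-⟂ {w = w} [] v≗0 = ∙-zeroˡ w v≗0
∈Span-⟂ {v = v} {w} {s ∷ S} (s⟂w ∷ S⟂w) (a , v⊕as∈S) = begin
  v ∙ w                      ≡⟨ xor-identityʳ (v ∙ w) ⟨
  (v ∙ w) xor false          ≡⟨ cong ((v ∙ w) xor_) (trans (cong (a ∧_) s⟂w) (∧-zeroʳ a)) ⟨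
  (v ∙ w) xor (a ∧ s ∙ w)    ≡⟨ ∙-⊕· v s w a ⟨
  (v ⊕ a · s) ∙ w            ≡⟨ ∈Span-⟂ S⟂w v⊕as∈S ⟩
  false                      ∎

lincombᶠ : (Fin m → Bool) → (Fin m → Vec₂ n) → Vec₂ n
lincombᶠ {m} c T j = ∑[ i < m ] (c i ∧ T i j)

Independentᶠ : (Fin m → Vec₂ n) → Set
Independentᶠ T = ∀ c → lincombᶠ c T ≗ zeroV → ∀ i → c i ≡ false

lincomb-zipC-tabulate : ∀ {k} (A : Fin k → Vec₂ n) is (c : Fin (length is) → Bool) →
  lincomb (zipC (tabulate c) (map A is)) ≗ lincombᶠ c (A ∘ lookup is)
lincomb-zipC-tabulate A []       c j = refl
lincomb-zipC-tabulate A (i ∷ is) c j =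
  cong ((c zero ∧ A i j) xor_) (lincomb-zipC-tabulate A is (c ∘ suc) j)

Independent⇒Independentᶠ : ∀ {k} (A : Fin k → Vec₂ n) is →
  Independent (map A is) → Independentᶠ (A ∘ lookup is)
Independent⇒Independentᶠ A is ind c c≗0 = tabulate⁻ (ind (tabulate c)
  (trans (length-tabulate c) (≡.sym (length-map A is)))
  (λ j → trans (lincomb-zipC-tabulate A is c j) (c≗0 j)))

∙-lincombᶠ : (c : Fin m → Bool) (T : Fin m → Vec₂ n) (w : Vec₂ n) →
  lincombᶠ c T ∙ w ≡ ∑[ i < m ] (c i ∧ T i ∙ w)
∙-lincombᶠ {m} {n} c T w = begin
  ∑[ j < n ] (∑[ i < m ] (c i ∧ T i j) ∧ w j)
    ≡⟨ sum-cong-≗ (λ j → *-distribʳ-sum (w j) (λ i → c i ∧ T i j)) ⟩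
  ∑[ j < n ] ∑[ i < m ] ((c i ∧ T i j) ∧ w j)
    ≡⟨ ∑-comm (λ j i → (c i ∧ T i j) ∧ w j) ⟩
  ∑[ i < m ] ∑[ j < n ] ((c i ∧ T i j) ∧ w j)
    ≡⟨ sum-cong-≗ (λ i → sum-cong-≗ (λ j → ∧-assoc (c i) (T i j) (w j))) ⟩
  ∑[ i < m ] ∑[ j < n ] (c i ∧ (T i j ∧ w j))
    ≡⟨ sum-cong-≗ (λ i → *-distribˡ-sum (c i) (λ j → T i j ∧ w j)) ⟨
  ∑[ i < m ] (c i ∧ T i ∙ w) ∎

-- A relation Σ cᵢ (T (punchIn p i) ⊕ aᵢ · T p) = 0 is the relation on T whose coefficient at p
-- is Σ cᵢ aᵢ.
Independentᶠ-eliminate : {T : Fin (suc m) → Vec₂ n} → Independentᶠ T →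
  ∀ p (a : Fin m → Bool) → Independentᶠ (λ i → T (punchIn p i) ⊕ a i · T p)
Independentᶠ-eliminate {m} {T = T} ind p a c c≗0 i =
  trans (≡.sym (insertAt-punchIn c p β i))
        (ind c′ (λ j → trans (lincomb-c′ j) (c≗0 j)) (punchIn p i))
  where
  β : Bool
  β = ∑[ k < m ] (c k ∧ a k)
  c′ : Fin (suc m) → Bool
  c′ = Vector.insertAt c p β
  lincomb-c′ : lincombᶠ c′ T ≗ lincombᶠ c (λ i → T (punchIn p i) ⊕ a i · T p)
  lincomb-c′ j = begin
    lincombᶠ c′ T j
      ≡⟨ sum-remove {i = p} (λ k → c′ k ∧ T k j) ⟩
    (c′ p ∧ T p j) xor ∑[ k < m ] (c′ (punchIn p k) ∧ T (punchIn p k) j)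
      ≡⟨ cong₂ (λ x y → (x ∧ T p j) xor y) (insertAt-lookup c p β)
               (sum-cong-≗ (λ k → cong (_∧ T (punchIn p k) j) (insertAt-punchIn c p β k))) ⟩
    (β ∧ T p j) xor ∑[ k < m ] (c k ∧ T (punchIn p k) j)
      ≡⟨ cong (_xor _) (*-distribʳ-sum (T p j) (λ k → c k ∧ a k)) ⟩
    ∑[ k < m ] ((c k ∧ a k) ∧ T p j) xor ∑[ k < m ] (c k ∧ T (punchIn p k) j)
      ≡⟨ ∑-distrib-+ (λ k → (c k ∧ a k) ∧ T p j) (λ k → c k ∧ T (punchIn p k) j) ⟨
    ∑[ k < m ] (((c k ∧ a k) ∧ T p j) xor (c k ∧ T (punchIn p k) j))
      ≡⟨ sum-cong-≗ (λ k → factor (c k) (a k) (T p j) (T (punchIn p k) j)) ⟩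
    lincombᶠ c (λ i → T (punchIn p i) ⊕ a i · T p) j ∎
    where
    factor : ∀ x y z t → ((x ∧ y) ∧ z) xor (x ∧ t) ≡ x ∧ (t xor (y ∧ z))
    factor = solve-∀ 𝔽₂

-- If some T i needs s, use it as pivot to eliminate s from the others; otherwise drop s.
steinitz : (S : List (Vec₂ n)) {m : ℕ} {T : Fin m → Vec₂ n} →
  Independentᶠ T → (∀ i → T i ∈Span S) → m ≤ length S
steinitz []      {m = zero}  _   _   = z≤n
steinitz []      {m = suc m} ind T∈S =
  contradiction (ind (λ _ → true) (λ j → ∑-zero (λ i → T∈S i j)) zero) λ ()
steinitz (s ∷ S) {m = zero}  _   _   = z≤n
steinitz (s ∷ S) {m = suc m} {T} ind T∈S with any? (λ i → proj₁ (T∈S i) Bool.≟ true)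
... | yes (p , ap≡true) =
  s≤s (steinitz S (Independentᶠ-eliminate {T = T} ind p (a ∘ punchIn p)) eliminated∈S)
  where
  a : Fin (suc m) → Bool
  a i = proj₁ (T∈S i)
  Tp⊕s∈S : T p ⊕ s ∈Span S
  Tp⊕s∈S = subst (λ x → T p ⊕ x · s ∈Span S) ap≡true (proj₂ (T∈S p))
  eliminated∈S : ∀ i → T (punchIn p i) ⊕ a (punchIn p i) · T p ∈Span S
  eliminated∈S i =
    ∈Span-resp-≗ S (λ j → cancel (T (punchIn p i) j) (a (punchIn p i)) (s j) (T p j))
      (∈Span-⊕ S (proj₂ (T∈S (punchIn p i))) (∈Span-· S (a (punchIn p i)) Tp⊕s∈S))
    where
    cancel : ∀ t b x y → (t xor (b ∧ x)) xor (b ∧ (y xor x)) ≡ t xor (b ∧ y)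
    cancel = solve-∀ 𝔽₂
... | no ∄p =
  m≤n⇒m≤1+n (steinitz S ind (λ i → ∈Span-resp-≗ S (T⊕0≗T i) (proj₂ (T∈S i))))
  where
  T⊕0≗T : ∀ i → T i ⊕ proj₁ (T∈S i) · s ≗ T i
  T⊕0≗T i j rewrite ¬-not (λ ai≡true → ∄p (i , ai≡true)) = xor-identityʳ (T i j)

Independentᶠ-∷ : {T : Fin m → Vec₂ n} {s w : Vec₂ n} →
  Independentᶠ T → (∀ i → T i ⟂ w) → s ∙ w ≡ true → Independentᶠ (s Vector.∷ T)
Independentᶠ-∷ {m} {T = T} {s} {w} ind T⟂w s∙w≡true c c≗0 = λ where
    zero    → c₀≡false
    (suc i) → ind (c ∘ suc) (λ j → trans (cong (λ x → (x ∧ s j) xor lincombᶠ (c ∘ suc) T j)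
                                               (≡.sym c₀≡false))
                                         (c≗0 j)) i
  where
  c₀≡false : c zero ≡ false
  c₀≡false = begin
    c zero                                       ≡⟨ ∧-identityʳ (c zero) ⟨
    c zero ∧ true                                ≡⟨ cong (c zero ∧_) s∙w≡true ⟨
    c zero ∧ s ∙ w                               ≡⟨ xor-identityʳ _ ⟨
    (c zero ∧ s ∙ w) xor false                   ≡⟨ cong (c zero ∧ s ∙ w xor_) (∑-zero c∘suc∧T⟂w) ⟨
    ∑[ i < suc m ] (c i ∧ (s Vector.∷ T) i ∙ w)  ≡⟨ ∙-lincombᶠ c (s Vector.∷ T) w ⟨
    lincombᶠ c (s Vector.∷ T) ∙ w                ≡⟨ ∙-zeroˡ w c≗0 ⟩
    false                                        ∎
    where
    c∘suc∧T⟂w : ∀ i → c (suc i) ∧ T i ∙ w ≡ false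
    c∘suc∧T⟂w i = trans (cong (c (suc i) ∧_) (T⟂w i)) (∧-zeroʳ (c (suc i)))

-- If s ∙ w ≡ true, then s ∷ T would be m + 1 independent vectors in the span of S.
independent⟂⇒spanning⟂ : {T : Fin m → Vec₂ n} {S : List (Vec₂ n)} {w : Vec₂ n} →
  Independentᶠ T → (∀ i → T i ∈Span S) → length S ≤ m → (∀ i → T i ⟂ w) →
  ∀ {s} → s ∈ S → s ⟂ w
independent⟂⇒spanning⟂ {m} {T = T} {S} ind T∈S |S|≤m T⟂w {s} s∈S = ¬-not λ s∙w≡true →
  n≮n m (≤-trans (steinitz S (Independentᶠ-∷ ind T⟂w s∙w≡true) s∷T∈S) |S|≤m)
  where
  s∷T∈S : ∀ i → (s Vector.∷ T) i ∈Span S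
  s∷T∈S zero    = ∈⇒∈Span s∈S
  s∷T∈S (suc i) = T∈S i

bicliqueMatrix : Biclique n → Fin n → Fin n → Bool
bicliqueMatrix B u v = (X B u ∧ Y B v) xor (Y B u ∧ X B v)

coverMatrix : List (Biclique n) → Fin n → Fin n → Bool
coverMatrix []      u v = false
coverMatrix (B ∷ O) u v = bicliqueMatrix B u v xor coverMatrix O u v

covers≡bicliqueMatrix : (B : Biclique n) (u v : Fin n) → covers B u v ≡ bicliqueMatrix B u v
covers≡bicliqueMatrix B u v with X B u | Y B u | disjoint B u
... | false | _     | _ = refl
... | true  | false | _ = trans (∨-identityʳ (Y B v)) (≡.sym (xor-identityʳ (Y B v)))
... | true  | true  | ()

coverMatrix-diag : (O : List (Biclique n)) (u : Fin n) → coverMatrix O u u ≡ false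
coverMatrix-diag []      u = refl
coverMatrix-diag (B ∷ O) u = cong₂ _xor_
  (trans (cong (_xor (Y B u ∧ X B u)) (∧-comm (X B u) (Y B u))) (xor-same (Y B u ∧ X B u)))
  (coverMatrix-diag O u)

isOdd-coverCount : (O : List (Biclique n)) (u v : Fin n) → isOdd (coverCount O u v) ≡ coverMatrix O u v
isOdd-coverCount []      u v = refl
isOdd-coverCount (B ∷ O) u v = trans (isOdd-+ (if covers B u v then 1 else 0) _)
  (cong₂ _xor_ (trans (isOdd-indicator (covers B u v)) (covers≡bicliqueMatrix B u v))
               (isOdd-coverCount O u v))

parts : List (Biclique n) → List (Vec₂ n)
parts []      = []
parts (B ∷ O) = X B ∷ Y B ∷ parts O

length-parts : (O : List (Biclique n)) → length (parts O) ≡ 2 * length O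
length-parts []      = refl
length-parts (B ∷ O) = trans (cong (2 +_) (length-parts O)) (≡.sym (*-suc 2 (length O)))

∈-parts : {B : Biclique n} {O : List (Biclique n)} → B ∈ O → X B ∈ parts O × Y B ∈ parts O
∈-parts (here refl) = here refl , there (here refl)
∈-parts (there B∈O) = Product.map (there ∘ there) (there ∘ there) (∈-parts B∈O)

All-parts : {P : Vec₂ n → Set} (O : List (Biclique n)) →
  (∀ {B} → B ∈ O → P (X B) × P (Y B)) → All P (parts O)
All-parts []      _ = []
All-parts (B ∷ O) h = proj₁ (h (here refl)) ∷ proj₂ (h (here refl)) ∷ All-parts O (h ∘ there)

coverMatrix-row∈Span : (O : List (Biclique n)) (u : Fin n) → coverMatrix O u ∈Span parts O
coverMatrix-row∈Span []      u j = refl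
coverMatrix-row∈Span (B ∷ O) u = Y B u , X B u ,
  ∈Span-resp-≗ (parts O) (λ v → cancel (X B u ∧ Y B v) (Y B u ∧ X B v) (coverMatrix O u v))
    (coverMatrix-row∈Span O u)
  where
  cancel : ∀ x y r → r ≡ (((x xor y) xor r) xor y) xor x
  cancel = solve-∀ 𝔽₂

even-count⇒⟂ : (u v : Vec₂ n) → Even (count (u ∩ v)) → u ⟂ v
even-count⇒⟂ u v even = trans (≡.sym (isOdd-count (u ∩ v))) (even⇒isOdd≡false even)

⟂⇒even-count : (u v : Vec₂ n) → u ⟂ v → Even (count (u ∩ v))
⟂⇒even-count u v u⟂v = isOdd≡false⇒even _ (trans (isOdd-count (u ∩ v)) u⟂v)

_<ᶠ_ : Fin n → Fin n → Bool
u <ᶠ v = ⌊ toℕ u <? toℕ v ⌋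

<ᶠ-trichotomy : (u v : Fin n) (x : Bool) → (u ≡ v → x ≡ false) →
  ((u <ᶠ v) ∧ x) xor ((v <ᶠ u) ∧ x) ≡ x
<ᶠ-trichotomy u v x diag with toℕ u <? toℕ v | toℕ v <? toℕ u
... | yes u<v | yes v<u = contradiction v<u (<-asym u<v)
... | yes _   | no _    = xor-identityʳ x
... | no _    | yes _   = refl
... | no u≮v  | no v≮u  = ≡.sym (diag (toℕ-injective (≤∧≮⇒≡ (≮⇒≥ v≮u) u≮v)))

∑∑-distrib-xor : (f g : Fin n → Fin n → Bool) →
  ∑[ u < n ] ∑[ v < n ] (f u v xor g u v) ≡
  ∑[ u < n ] ∑[ v < n ] f u v xor ∑[ u < n ] ∑[ v < n ] g u v
∑∑-distrib-xor {n} f g = trans (sum-cong-≗ (λ u → ∑-distrib-+ (f u) (g u)))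
  (∑-distrib-+ (λ u → ∑[ v < n ] f u v) (λ u → ∑[ v < n ] g u v))

∑-upper-symmetrise : (h : Fin n → Fin n → Bool) → (∀ u → h u u ≡ false) →
  ∑[ u < n ] ∑[ v < n ] ((u <ᶠ v) ∧ (h u v xor h v u)) ≡ ∑[ u < n ] ∑[ v < n ] h u v
∑-upper-symmetrise {n} h h-diag = begin
  ∑[ u < n ] ∑[ v < n ] ((u <ᶠ v) ∧ (h u v xor h v u))
    ≡⟨ sum-cong-≗ (λ u → sum-cong-≗ (λ v → ∧-distribˡ-xor (u <ᶠ v) (h u v) (h v u))) ⟩
  ∑[ u < n ] ∑[ v < n ] (((u <ᶠ v) ∧ h u v) xor ((u <ᶠ v) ∧ h v u))
    ≡⟨ ∑∑-distrib-xor (λ u v → (u <ᶠ v) ∧ h u v) (λ u v → (u <ᶠ v) ∧ h v u) ⟩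
  ∑[ u < n ] ∑[ v < n ] ((u <ᶠ v) ∧ h u v) xor ∑[ u < n ] ∑[ v < n ] ((u <ᶠ v) ∧ h v u)
    ≡⟨ cong (∑[ u < n ] ∑[ v < n ] ((u <ᶠ v) ∧ h u v) xor_)
            (∑-comm (λ u v → (u <ᶠ v) ∧ h v u)) ⟩
  ∑[ u < n ] ∑[ v < n ] ((u <ᶠ v) ∧ h u v) xor ∑[ u < n ] ∑[ v < n ] ((v <ᶠ u) ∧ h u v)
    ≡⟨ ∑∑-distrib-xor (λ u v → (u <ᶠ v) ∧ h u v) (λ u v → (v <ᶠ u) ∧ h u v) ⟨
  ∑[ u < n ] ∑[ v < n ] (((u <ᶠ v) ∧ h u v) xor ((v <ᶠ u) ∧ h u v))
    ≡⟨ sum-cong-≗ (λ u → sum-cong-≗ (λ v →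
         <ᶠ-trichotomy u v (h u v) λ { refl → h-diag u })) ⟩
  ∑[ u < n ] ∑[ v < n ] h u v ∎

inducedEdgeParity : (Fin n → Fin n → Bool) → Vec₂ n → Bool
inducedEdgeParity {n} A W = ∑[ u < n ] ∑[ v < n ] ((u <ᶠ v) ∧ A u v ∧ W u ∧ W v)

isOdd-inducedEdges : (G : Graph n) (W : VSet n) → isOdd (inducedEdges G W) ≡ inducedEdgeParity (adj G) W
isOdd-inducedEdges G W = trans (isOdd-sumFin (λ u → count (edgeTo u)))
  (sum-cong-≗ (λ u → isOdd-count (edgeTo u)))
  where
  edgeTo : Fin _ → Fin _ → Bool
  edgeTo u v = (u <ᶠ v) ∧ adj G u v ∧ W u ∧ W v

inducedEdgeParity-cong : {A A′ : Fin n → Fin n → Bool} (W : Vec₂ n) →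
  (∀ u v → A u v ≡ A′ u v) →
  inducedEdgeParity A W ≡ inducedEdgeParity A′ W
inducedEdgeParity-cong W A≡A′ =
  sum-cong-≗ (λ u → sum-cong-≗ (λ v →
    cong (λ x → (u <ᶠ v) ∧ x ∧ W u ∧ W v) (A≡A′ u v)))

inducedEdgeParity-xor : (A A′ : Fin n → Fin n → Bool) (W : Vec₂ n) →
  inducedEdgeParity (λ u v → A u v xor A′ u v) W ≡ inducedEdgeParity A W xor inducedEdgeParity A′ W
inducedEdgeParity-xor A A′ W = trans
  (sum-cong-≗ (λ u → sum-cong-≗ (λ v → distrib (u <ᶠ v) (A u v) (A′ u v) (W u ∧ W v))))
  (∑∑-distrib-xor (λ u v → (u <ᶠ v) ∧ A u v ∧ W u ∧ W v)
                  (λ u v → (u <ᶠ v) ∧ A′ u v ∧ W u ∧ W v))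
  where
  distrib : ∀ l a a′ w → l ∧ (a xor a′) ∧ w ≡ (l ∧ a ∧ w) xor (l ∧ a′ ∧ w)
  distrib = solve-∀ 𝔽₂

inducedEdgeParity-biclique : (B : Biclique n) (W : Vec₂ n) →
  inducedEdgeParity (bicliqueMatrix B) W ≡ X B ∙ W ∧ Y B ∙ W
inducedEdgeParity-biclique {n} B W = begin
  inducedEdgeParity (bicliqueMatrix B) W
    ≡⟨ sum-cong-≗ (λ u → sum-cong-≗ (λ v →
         regroup (u <ᶠ v) (X B u) (Y B u) (X B v) (Y B v) (W u) (W v))) ⟩
  ∑[ u < n ] ∑[ v < n ] ((u <ᶠ v) ∧ (h u v xor h v u))
    ≡⟨ ∑-upper-symmetrise h h-diag ⟩
  ∑[ u < n ] ∑[ v < n ] ((X B u ∧ W u) ∧ (Y B v ∧ W v))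
    ≡⟨ sum-cong-≗ (λ u → *-distribˡ-sum (X B u ∧ W u) (λ v → Y B v ∧ W v)) ⟨
  ∑[ u < n ] ((X B u ∧ W u) ∧ Y B ∙ W)
    ≡⟨ *-distribʳ-sum (Y B ∙ W) (λ u → X B u ∧ W u) ⟨
  X B ∙ W ∧ Y B ∙ W ∎
  where
  h : Fin n → Fin n → Bool
  h u v = (X B u ∧ W u) ∧ (Y B v ∧ W v)
  regroup : ∀ l xu yu xv yv wu wv →
    l ∧ ((xu ∧ yv) xor (yu ∧ xv)) ∧ wu ∧ wv ≡
    l ∧ (((xu ∧ wu) ∧ (yv ∧ wv)) xor ((xv ∧ wv) ∧ (yu ∧ wu)))
  regroup = solve-∀ 𝔽₂
  h-diag : ∀ u → h u u ≡ false
  h-diag u = trans (pair (X B u) (Y B u) (W u)) (cong (_∧ (W u ∧ W u)) (disjoint B u))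
    where
    pair : ∀ x y w → (x ∧ w) ∧ (y ∧ w) ≡ (x ∧ y) ∧ (w ∧ w)
    pair = solve-∀ 𝔽₂

inducedEdgeParity-coverMatrix : (O : List (Biclique n)) {W : Vec₂ n} →
  (∀ {B} → B ∈ O → X B ⟂ W) → inducedEdgeParity (coverMatrix O) W ≡ false
inducedEdgeParity-coverMatrix {n} [] _ =
  ∑-zero (λ u → ∑-zero {n} (λ v → ∧-zeroʳ (u <ᶠ v)))
inducedEdgeParity-coverMatrix (B ∷ O) {W} O⟂W = begin
  inducedEdgeParity (coverMatrix (B ∷ O)) W
    ≡⟨ inducedEdgeParity-xor (bicliqueMatrix B) (coverMatrix O) W ⟩
  inducedEdgeParity (bicliqueMatrix B) W xor inducedEdgeParity (coverMatrix O) W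
    ≡⟨ cong₂ _xor_ (trans (inducedEdgeParity-biclique B W) (cong (_∧ Y B ∙ W) (O⟂W (here refl))))
                   (inducedEdgeParity-coverMatrix O (O⟂W ∘ there)) ⟩
  false ∎

module _ {G : Graph n} {O : List (Biclique n)} (cover : IsOddCover G O) where

  adj≡isOdd-coverCount : ∀ {u v} → u ≢ v → adj G u v ≡ isOdd (coverCount O u v)
  adj≡isOdd-coverCount {u} {v} u≢v with adj G u v in eq | cover u v u≢v
  ... | true  | odd , _  = ≡.sym (odd⇒isOdd≡true _ (odd refl))
  ... | false | _ , even = ≡.sym (even⇒isOdd≡false (even refl))

  adj≡coverMatrix : ∀ u v → adj G u v ≡ coverMatrix O u v
  adj≡coverMatrix u v with u Fin.≟ v
  ... | yes refl = trans (irref G u) (≡.sym (coverMatrix-diag O u))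
  ... | no u≢v   = trans (adj≡isOdd-coverCount u≢v) (isOdd-coverCount O u v)

  rows∈Span-parts : ∀ u → adj G u ∈Span parts O
  rows∈Span-parts u =
    ∈Span-resp-≗ (parts O) (λ v → ≡.sym (adj≡coverMatrix u v)) (coverMatrix-row∈Span O u)

  rank≤2*length : ∀ {r} → IsR₂ G r → r ≤ 2 * length O
  rank≤2*length ((is , refl , ind) , _) = subst (length is ≤_) (length-parts O)
    (steinitz (parts O) (Independent⇒Independentᶠ (adj G) is ind) (rows∈Span-parts ∘ lookup is))

  evenCore⟂parts : ∀ {r W} → IsR₂ G r → 2 * length O ≡ r → IsEvenCore G W →
    ∀ {B} → B ∈ O → X B ⟂ W × Y B ⟂ W
  evenCore⟂parts {W = W} ((is , |is|≡r , ind) , _) perfect (_ , evenDegrees) B∈O =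
    Product.map parts⟂W parts⟂W (∈-parts B∈O)
    where
    parts⟂W : ∀ {s} → s ∈ parts O → s ⟂ W
    parts⟂W = independent⟂⇒spanning⟂ (Independent⇒Independentᶠ (adj G) is ind)
      (rows∈Span-parts ∘ lookup is)
      (≤-reflexive (trans (length-parts O) (trans perfect (≡.sym |is|≡r))))
      (λ i → even-count⇒⟂ (adj G (lookup is i)) W (evenDegrees (lookup is i)))

  parts⟂⇒evenCore : ∀ {W} → Nonempty W → (∀ {B} → B ∈ O → X B ⟂ W × Y B ⟂ W) →
    IsEvenCore G W
  parts⟂⇒evenCore {W} W≠∅ O⟂W =
    W≠∅ , λ v → ⟂⇒even-count (adj G v) W (∈Span-⟂ (All-parts O O⟂W) (rows∈Span-parts v))

  evenCore⇔evenTraces : ∀ {r} → IsR₂ G r → 2 * length O ≡ r → ∀ W →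
    IsEvenCore G W ⇔
    (Nonempty W × (∀ B → B ∈ O → Even (count (W ∩ X B)) × Even (count (W ∩ Y B))))
  evenCore⇔evenTraces rank perfect W = mk⇔
    (λ core → proj₁ core , λ B B∈O →
      Product.map ⟂⇒evenTrace ⟂⇒evenTrace (evenCore⟂parts rank perfect core B∈O))
    (λ (W≠∅ , evenTraces) → parts⟂⇒evenCore W≠∅ λ {B} B∈O →
      Product.map evenTrace⇒⟂ evenTrace⇒⟂ (evenTraces B B∈O))
    where
    ⟂⇒evenTrace : ∀ {s} → s ⟂ W → Even (count (W ∩ s))
    ⟂⇒evenTrace {s} = ⟂⇒even-count W s ∘ ⟂-sym s W
    evenTrace⇒⟂ : ∀ {s} → Even (count (W ∩ s)) → s ⟂ W
    evenTrace⇒⟂ {s} = ⟂-sym W s ∘ even-count⇒⟂ W s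

  evenCoreWithOddEdges⇒imperfect : ∀ {r W} →
    IsR₂ G r → IsEvenCore G W → Odd (inducedEdges G W) → r < 2 * length O
  evenCoreWithOddEdges⇒imperfect {W = W} rank core odd =
    ≤∧≢⇒< (rank≤2*length rank) λ r≡2|O| → odd (isOdd≡false⇒even _ (begin
      isOdd (inducedEdges G W)             ≡⟨ isOdd-inducedEdges G W ⟩
      inducedEdgeParity (adj G) W          ≡⟨ inducedEdgeParity-cong W adj≡coverMatrix ⟩
      inducedEdgeParity (coverMatrix O) W  ≡⟨ inducedEdgeParity-coverMatrix O
                                                (proj₁ ∘ evenCore⟂parts rank (≡.sym r≡2|O|) core) ⟩
      false                                ∎))

corollary5 :
    (∀ {n} (G : Graph n) (r : ℕ) → IsR₂ G r →
      (O : List (Biclique n)) → IsOddCover G O → 2 * length O ≡ r →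
      ∀ (W : VSet n) → IsEvenCore G W ⇔
        (Nonempty W × (∀ B → B ∈ O → Even (count (W ∩ X B)) × Even (count (W ∩ Y B)))))
    × (∀ {n} (G : Graph n) (r : ℕ) → IsR₂ G r →
      ∀ (W : VSet n) → IsEvenCore G W → Odd (inducedEdges G W) →
      ∀ (O′ : List (Biclique n)) → IsOddCover G O′ → r < 2 * length O′)
corollary5 =
    (λ G r rank O cover perfect → evenCore⇔evenTraces {G = G} {O} cover rank perfect)
  , (λ G r rank W core odd O cover → evenCoreWithOddEdges⇒imperfect {G = G} {O} cover rank core odd)
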